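{- In the game of Knights and Spies with parameters $n$ and $\ell$, $1 \le \ell < n/2$, the Secret-Keeper has a strategy (obeying the rules of the game) which ensures that the Interrogator cannot make a successful claim before she has asked $n+\ell-1$ questions; that is, whatever questions the Interrogator asks, after any number of questions fewer than $n+\ell-1$ there are at least two different subsets of $\{1,\dots,n\}$ consistent with the answers given.
   Context: The game of Knights and Spies is played between an Interrogator and a Secret-Keeper, on $n$ people labelled $1,\dots,n$, with a parameter $\ell$, $1\le \ell<n/2$. In each turn the Interrogator asks a question of the form "Person $i$, what is the identity of person $j$?", and the Secret-Keeper answers "knight" or "spy". A subset $S \subseteq \{1,\dots,n\}$ (the putative set of spies) is consistent with the answers so far if $|S| \le \ell$ and, for every question asked to a person $i \notin S$ about person $j$, the answer was "spy" if $j\in S$ and "knight" if $j\notin S$ (people not in $S$ are knights, who always tell the truth; spies may answer either way). The Secret-Keeper is not committed to any particular set, but must answer so that at every point at least one consistent subset exists. At the start of a turn the Interrogator may claim by naming a set of spies; the claim succeeds if it is the unique consistent subset, otherwise the Secret-Keeper refutes it by exhibiting another consistent subset. -}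

module Defs where

open import Data.Nat using (ℕ; _≤_)
open import Data.Bool using (Bool; true; false)
open import Data.Fin using (Fin)
open import Data.Fin.Subset using (Subset; _∉_; ∣_∣)
open import Data.Vec using (lookup)
open import Data.Product using (_×_; _,_)
open import Data.List using (List; []; _∷_)
open import Data.List.Relation.Unary.All using (All)
open import Relation.Binary.PropositionalEquality using (_≡_)

-- A question "Person i, what is the identity of person j?" is the pair (i , j).
Question : ℕ → Set
Question n = Fin n × Fin n

-- An answer: true = "spy", false = "knight".
Answer : Set
Answer = Bool

Record : ℕ → Set
Record n = Question n × Answer

-- History of questions and answers, MOST RECENT FIRST.
History : ℕ → Set
History n = List (Record n)

-- A putative spy set S (as a Data.Fin.Subset: lookup S j ≡ true iff j ∈ S)
-- agrees with one recorded answer if: whenever the asked person i is not in S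
-- (hence a knight), the answer is "spy" iff j ∈ S.
Agrees : ∀ {n} → Subset n → Record n → Set
Agrees S ((i , j) , a) = i ∉ S → a ≡ lookup S j

Consistent : ∀ {n} → ℕ → History n → Subset n → Set
Consistent ℓ h S = (∣ S ∣ ≤ ℓ) × All (Agrees S) h

Strategy : ℕ → Set
Strategy n = History n → Question n → Answer

-- The history produced when the Secret-Keeper plays σ against the question
-- sequence qs (qs listed MOST RECENT FIRST).  Since σ is deterministic, an
-- adaptive Interrogator is captured by quantifying over all question sequences.
play : ∀ {n} → Strategy n → List (Question n) → History n
play σ [] = []
play σ (q ∷ qs) = (q , σ (play σ qs) q) ∷ play σ qs

-- Call the spy answers ("accusations") of a history the edges of a graph; a
-- set T of people COVERS the history when every accusation has an endpoint in
-- T, and T is SMALL when ∣ T ∣ < ℓ.  The Secret-Keeper answers "spy" to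
-- "i, who is j?" exactly when i ≢ j and some small cover of the history so far
-- also covers (i , j).  By induction on the play this keeps the history
-- SOUND: a small cover exists, no accusation is a self-accusation, and no
-- knight answer "i says j is a knight" (i ≢ j) names a member of a small
-- cover.  Every small cover of a sound history is consistent.
--
-- For ambiguity fix a small cover S.  If ∣ S ∣ + 1 < ℓ, S and S ∪ {u} (u ∉ S)
-- are two small covers.  Otherwise each person p is CHARGED with the answers
-- it owns: for p ∉ S the knight answers "… j is a knight" about j = p, for
-- p ∈ S the accusations covered by S but not by S - p.  Unless two distinct
-- consistent sets appear, p ∉ S owns at least one answer and p ∈ S at least
-- two; as every answer has at most one owner, the history has at least
-- n + ∣ S ∣ = n + ℓ - 1 answers.

module Submission where

open import Defs
open import Data.Nat using (ℕ; zero; suc; _≤_; _<_; _+_; _*_; _∸_; z≤n; s≤s; _≤?_; _<?_)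
open import Data.Nat.Properties
  using (≤-trans; ≤-reflexive; <⇒≤; ≤-<-trans; <⇒≱; ≮⇒≥; n≤1+n; m≤m+n; m≤n+m;
         +-suc; +-comm; +-mono-≤; +-monoʳ-≤; ∸-monoˡ-≤; +-0-commutativeMonoid; module ≤-Reasoning)
open import Algebra.Properties.CommutativeMonoid.Sum +-0-commutativeMonoid
  using (sum-syntax; ∑-distrib-+; sum-replicate-zero)
open import Data.Bool using (true; false; if_then_else_)
open import Data.Fin using (Fin; zero; suc; _≟_)
open import Data.Fin.Properties using (suc-injective; ¬∀⟶∃¬)
open import Data.Fin.Subset
  using (Subset; inside; outside; _∈_; _∉_; _⊆_; ⁅_⁆; _∪_; _-_; ∣_∣) renaming (⊥ to ∅; ⊤ to everyone)
open import Data.Fin.Subset.Properties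
  using (_∈?_; ∣⊥∣≡0; ∣⊤∣≡n; ∣⁅x⁆∣≡1; p⊆q⇒∣p∣≤∣q∣; x∈⁅x⁆; x∈⁅y⁆⇒x≡y; p⊆p∪q; q⊆p∪q;
         x∈p∪q⁻; x∈p∧x≢y⇒x∈p-y; x∈p⇒∣p-x∣<∣p∣; anySubset?)
open import Data.Vec using ([]; _∷_; lookup; here; there)
open import Data.Vec.Properties using ([]=⇒lookup; lookup⇒[]=)
open import Data.List using (List; []; _∷_; length)
open import Data.List.Relation.Unary.All as All using (All; []; _∷_)
open import Data.List.Relation.Unary.All.Properties using (¬All⇒Any¬; ¬Any⇒All¬)
open import Data.List.Relation.Unary.Any as Any using (any?)
open import Data.List.Membership.Propositional using (find) renaming (_∈_ to _∈ₗ_)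
open import Data.Product using (Σ; ∃; _×_; _,_; proj₁; proj₂; uncurry)
open import Data.Sum as Sum using (_⊎_; inj₁; inj₂; [_,_]′)
open import Data.Unit using (⊤; tt)
open import Function using (_∘_; id)
open import Relation.Nullary
  using (¬_; Dec; yes; no; does; proof; Reflects; ofʸ; ofⁿ; ¬?; _×-dec_; _⊎-dec_;
         contradiction; decidable-stable)
open import Relation.Unary using (Decidable)
open import Relation.Binary.PropositionalEquality
  using (_≡_; _≢_; refl; sym; trans; cong; subst)

indicator : ∀ {A : Set} → Dec A → ℕ
indicator d = if does d then 1 else 0

module _ {A : Set} {P : A → Set} (P? : Decidable P) where

  count : List A → ℕ
  count [] = 0
  count (x ∷ xs) = indicator (P? x) + count xs

  count-∈ : ∀ {x xs} → x ∈ₗ xs → P x → 1 ≤ count xs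
  count-∈ {x} (Any.here refl) px with P? x
  ... | yes _ = s≤s z≤n
  ... | no ¬px = contradiction px ¬px
  count-∈ {xs = y ∷ _} (Any.there x∈xs) px = ≤-trans (count-∈ x∈xs px) (m≤n+m _ (indicator (P? y)))

  count-∈₂ : ∀ {x y xs} → x ∈ₗ xs → y ∈ₗ xs → x ≢ y → P x → P y → 2 ≤ count xs
  count-∈₂ (Any.here refl) (Any.here refl) x≢y _ _ = contradiction refl x≢y
  count-∈₂ {x} (Any.here refl) (Any.there y∈xs) _ px py with P? x
  ... | yes _ = s≤s (count-∈ y∈xs py)
  ... | no ¬px = contradiction px ¬px
  count-∈₂ {y = y} (Any.there x∈xs) (Any.here refl) _ px py with P? y
  ... | yes _ = s≤s (count-∈ x∈xs px)
  ... | no ¬py = contradiction py ¬py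
  count-∈₂ {xs = z ∷ _} (Any.there x∈xs) (Any.there y∈xs) x≢y px py =
    ≤-trans (count-∈₂ x∈xs y∈xs x≢y px py) (m≤n+m _ (indicator (P? z)))

∑-mono : ∀ {n} {f g : Fin n → ℕ} → (∀ p → f p ≤ g p) → ∑[ p < n ] f p ≤ ∑[ p < n ] g p
∑-mono {zero} _ = z≤n
∑-mono {suc n} f≤g = +-mono-≤ (f≤g zero) (∑-mono (f≤g ∘ suc))

∑-indicator≤1 : ∀ {n} {R : Fin n → Set} (R? : Decidable R) →
  (∀ {p q} → R p → R q → p ≡ q) → ∑[ p < n ] indicator (R? p) ≤ 1
∑-indicator≤1 {zero} R? unique = z≤n
∑-indicator≤1 {suc n} R? unique with R? zero
... | no _ = ∑-indicator≤1 (R? ∘ suc) (λ r r′ → suc-injective (unique r r′))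
... | yes r₀ = s≤s (≤-trans (∑-mono none) (≤-reflexive (sum-replicate-zero n)))
  where
  none : ∀ p → indicator (R? (suc p)) ≤ 0
  none p with R? (suc p)
  ... | yes r = contradiction (unique r₀ r) λ ()
  ... | no _ = z≤n

∑-count≤length : ∀ {n} {A : Set} {R : Fin n → A → Set} (R? : ∀ p → Decidable (R p)) →
  (∀ {p q x} → R p x → R q x → p ≡ q) → ∀ xs → ∑[ p < n ] count (R? p) xs ≤ length xs
∑-count≤length {n} R? unique [] = ≤-reflexive (sum-replicate-zero n)
∑-count≤length {n} R? unique (x ∷ xs) = begin
  ∑[ p < n ] (indicator (R? p x) + count (R? p) xs)
    ≡⟨ ∑-distrib-+ (λ p → indicator (R? p x)) (λ p → count (R? p) xs) ⟩
  ∑[ p < n ] indicator (R? p x) + ∑[ p < n ] count (R? p) xs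
    ≤⟨ +-mono-≤ (∑-indicator≤1 (λ p → R? p x) unique) (∑-count≤length R? unique xs) ⟩
  suc (length xs) ∎
  where open ≤-Reasoning

∣p∪q∣≤∣p∣+∣q∣ : ∀ {n} (p q : Subset n) → ∣ p ∪ q ∣ ≤ ∣ p ∣ + ∣ q ∣
∣p∪q∣≤∣p∣+∣q∣ [] [] = z≤n
∣p∪q∣≤∣p∣+∣q∣ (outside ∷ p) (outside ∷ q) = ∣p∪q∣≤∣p∣+∣q∣ p q
∣p∪q∣≤∣p∣+∣q∣ (inside ∷ p) (outside ∷ q) = s≤s (∣p∪q∣≤∣p∣+∣q∣ p q)
∣p∪q∣≤∣p∣+∣q∣ (inside ∷ p) (inside ∷ q) =
  s≤s (≤-trans (∣p∪q∣≤∣p∣+∣q∣ p q) (+-monoʳ-≤ ∣ p ∣ (n≤1+n ∣ q ∣)))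
∣p∪q∣≤∣p∣+∣q∣ (outside ∷ p) (inside ∷ q) =
  ≤-trans (s≤s (∣p∪q∣≤∣p∣+∣q∣ p q)) (≤-reflexive (sym (+-suc ∣ p ∣ ∣ q ∣)))

∣p∪⁅x⁆∣≤1+∣p∣ : ∀ {n} (p : Subset n) x → ∣ p ∪ ⁅ x ⁆ ∣ ≤ suc ∣ p ∣
∣p∪⁅x⁆∣≤1+∣p∣ p x = ≤-trans (∣p∪q∣≤∣p∣+∣q∣ p ⁅ x ⁆)
  (≤-reflexive (trans (cong (∣ p ∣ +_) (∣⁅x⁆∣≡1 x)) (+-comm ∣ p ∣ 1)))

x∉p-x : ∀ {n} (p : Subset n) x → x ∉ p - x
x∉p-x (s ∷ p) zero ()
x∉p-x (s ∷ p) (suc x) (there x∈p-x) = x∉p-x p x x∈p-x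

x∈p∧x∉p-y⇒x≡y : ∀ {n} {p : Subset n} {x y} → x ∈ p → x ∉ p - y → x ≡ y
x∈p∧x∉p-y⇒x≡y {x = x} {y} x∈p x∉p-y = decidable-stable (x ≟ y) (x∉p-y ∘ x∈p∧x≢y⇒x∈p-y x∈p)

nonmember : ∀ {n} (p : Subset n) → ∣ p ∣ < n → ∃ λ x → x ∉ p
nonmember {n} p small = ¬∀⟶∃¬ n (_∈ p) (_∈? p) λ full →
  <⇒≱ small (subst (_≤ ∣ p ∣) (∣⊤∣≡n n) (p⊆q⇒∣p∣≤∣q∣ {p = everyone} (λ {x} _ → full x)))

∉⇒lookup≡false : ∀ {n} {p : Subset n} {x} → x ∉ p → lookup p x ≡ false
∉⇒lookup≡false {p = p} {x} x∉p with lookup p x in eq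
... | false = refl
... | true = contradiction (lookup⇒[]= x p eq) x∉p

separated : ∀ {n} {S T : Subset n} {p} → p ∈ S → p ∉ T → S ≢ T
separated p∈S p∉T refl = p∉T p∈S

Covers : ∀ {n} → Subset n → Question n → Set
Covers T (i , j) = i ∈ T ⊎ j ∈ T

covers? : ∀ {n} (T : Subset n) → Decidable (Covers T)
covers? T (i , j) = (i ∈? T) ⊎-dec (j ∈? T)

covers-mono : ∀ {n} {S T : Subset n} {q} → S ⊆ T → Covers S q → Covers T q
covers-mono S⊆T = Sum.map S⊆T S⊆T

CoversAnswer : ∀ {n} → Subset n → Record n → Set
CoversAnswer T (q , true) = Covers T q
CoversAnswer T (q , false) = ⊤

coversAnswer? : ∀ {n} (T : Subset n) → Decidable (CoversAnswer T)
coversAnswer? T (q , true) = covers? T q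
coversAnswer? T (q , false) = yes tt

Cover : ∀ {n} → Subset n → History n → Set
Cover T h = All (CoversAnswer T) h

cover? : ∀ {n} (T : Subset n) → Decidable (Cover T)
cover? T = All.all? (coversAnswer? T)

cover-mono : ∀ {n} {S T : Subset n} {h} → S ⊆ T → Cover S h → Cover T h
cover-mono {S = S} {T} S⊆T = All.map mono
  where
  mono : ∀ {r} → CoversAnswer S r → CoversAnswer T r
  mono {_ , true} = covers-mono S⊆T
  mono {_ , false} = id

SmallCover : ∀ {n} → ℕ → History n → Subset n → Set
SmallCover ℓ h T = ∣ T ∣ < ℓ × Cover T h

uncovered : ∀ {n} {S X : Subset n} {h} → Cover S h → ¬ Cover X h →
  ∃ λ q → (q , true) ∈ₗ h × Covers S q × ¬ Covers X q
uncovered {X = X} {h} covS ¬covX with find (¬All⇒Any¬ (coversAnswer? X) h ¬covX)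
... | (q , true) , r∈h , ¬c = q , r∈h , All.lookup covS r∈h , ¬c
... | (q , false) , _ , ¬c = contradiction tt ¬c

SpyAllowed : ∀ {n} → ℕ → History n → Question n → Set
SpyAllowed ℓ h (i , j) = i ≢ j × ∃ λ T → SmallCover ℓ h T × Covers T (i , j)

spyAllowed? : ∀ {n} ℓ (h : History n) → Decidable (SpyAllowed ℓ h)
spyAllowed? ℓ h (i , j) = ¬? (i ≟ j) ×-dec
  anySubset? (λ T → ((∣ T ∣ <? ℓ) ×-dec cover? T h) ×-dec covers? T (i , j))

keeper : ∀ {n} → ℕ → Strategy n
keeper ℓ h q = does (spyAllowed? ℓ h q)

keeper-reflects : ∀ {n} ℓ (h : History n) q → Reflects (SpyAllowed ℓ h q) (keeper ℓ h q)
keeper-reflects ℓ h q = proof (spyAllowed? ℓ h q)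

Justified : ∀ {n} → ℕ → History n → Record n → Set
Justified ℓ h ((i , j) , true) = i ≢ j
Justified ℓ h ((i , j) , false) = i ≢ j → ∀ {T} → SmallCover ℓ h T → j ∉ T

-- Justification survives later answers: small covers of a longer history are
-- small covers of the shorter one.
justified-∷ : ∀ {n ℓ} {h : History n} {r′ r} → Justified ℓ h r → Justified ℓ (r′ ∷ h) r
justified-∷ {r = (_ , true)} i≢j = i≢j
justified-∷ {r = (_ , false)} forced i≢j (lt , _ ∷ cov) = forced i≢j (lt , cov)

record Sound {n} (ℓ : ℕ) (h : History n) : Set where
  field
    cover : Subset n
    small : SmallCover ℓ h cover
    justified : All (Justified ℓ h) h

sound-∷ : ∀ {n ℓ} {h : History n} → Sound ℓ h → ∀ q → Sound ℓ ((q , keeper ℓ h q) ∷ h)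
sound-∷ {ℓ = ℓ} {h} s (i , j) with keeper ℓ h (i , j) | keeper-reflects ℓ h (i , j)
... | true | ofʸ (i≢j , T , (lt , cov) , covers) = record
  { cover = T ; small = lt , covers ∷ cov
  ; justified = i≢j ∷ All.map justified-∷ (Sound.justified s) }
... | false | ofⁿ ¬allowed = record
  { cover = Sound.cover s ; small = proj₁ (Sound.small s) , tt ∷ proj₂ (Sound.small s)
  ; justified = forced ∷ All.map justified-∷ (Sound.justified s) }
  where
  forced : i ≢ j → ∀ {T} → SmallCover ℓ (((i , j) , false) ∷ h) T → j ∉ T
  forced i≢j (lt , _ ∷ cov) j∈T = ¬allowed (i≢j , _ , (lt , cov) , inj₂ j∈T)

-- Every play of keeper is sound (the empty set is a small cover as ℓ ≥ 1).
sound-play : ∀ {n ℓ} → 1 ≤ ℓ → (qs : List (Question n)) → Sound ℓ (play (keeper ℓ) qs)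
sound-play {n} {ℓ} ℓ≥1 [] = record
  { cover = ∅ ; small = subst (_< ℓ) (sym (∣⊥∣≡0 n)) ℓ≥1 , [] ; justified = [] }
sound-play ℓ≥1 (q ∷ qs) = sound-∷ (sound-play ℓ≥1 qs) q

length-play : ∀ {n} (σ : Strategy n) qs → length (play σ qs) ≡ length qs
length-play σ [] = refl
length-play σ (q ∷ qs) = cong suc (length-play σ qs)

KnightClear : ∀ {n} → Subset n → Record n → Set
KnightClear T ((i , j) , false) = i ≢ j → j ∉ T
KnightClear T (_ , true) = ⊤

agrees : ∀ {n} {T : Subset n} {r} → CoversAnswer T r → KnightClear T r → Agrees T r
agrees {r = ((i , j) , true)} (inj₁ i∈T) _ i∉T = contradiction i∈T i∉T
agrees {r = ((i , j) , true)} (inj₂ j∈T) _ _ = sym ([]=⇒lookup j∈T)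
agrees {r = ((i , j) , false)} _ clear i∉T with i ≟ j
... | yes refl = sym (∉⇒lookup≡false i∉T)
... | no i≢j = sym (∉⇒lookup≡false (clear i≢j))

consistent : ∀ {n ℓ} {h : History n} {T} → ∣ T ∣ ≤ ℓ → Cover T h → All (KnightClear T) h →
  Consistent ℓ h T
consistent size cov clear = size , All.zipWith (uncurry agrees) (cov , clear)

smallCover-clear : ∀ {n ℓ} {h : History n} {T} → All (Justified ℓ h) h → SmallCover ℓ h T →
  All (KnightClear T) h
smallCover-clear {ℓ = ℓ} {h} {T} justified small = All.map clear justified
  where
  clear : ∀ {r} → Justified ℓ h r → KnightClear T r
  clear {(_ , true)} _ = tt
  clear {(_ , false)} forced i≢j = forced i≢j small

smallCover-consistent : ∀ {n ℓ} {h : History n} {T} → All (Justified ℓ h) h →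
  SmallCover ℓ h T → Consistent ℓ h T
smallCover-consistent justified small =
  consistent (<⇒≤ (proj₁ small)) (proj₂ small) (smallCover-clear justified small)

Owns : ∀ {n} → Subset n → Fin n → Record n → Set
Owns S p (q , true) = Covers S q × ¬ Covers (S - p) q
Owns S p ((i , j) , false) = i ≢ j × j ≡ p

owns? : ∀ {n} (S : Subset n) p → Decidable (Owns S p)
owns? S p (q , true) = covers? S q ×-dec ¬? (covers? (S - p) q)
owns? S p ((i , j) , false) = ¬? (i ≟ j) ×-dec (j ≟ p)

owner-unique : ∀ {n} {S : Subset n} {p p′ r} → Owns S p r → Owns S p′ r → p ≡ p′
owner-unique {r = ((x , y) , true)} (inj₁ x∈S , ¬c) (_ , ¬c′) =
  trans (sym (x∈p∧x∉p-y⇒x≡y x∈S (¬c ∘ inj₁))) (x∈p∧x∉p-y⇒x≡y x∈S (¬c′ ∘ inj₁))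
owner-unique {r = ((x , y) , true)} (inj₂ y∈S , ¬c) (_ , ¬c′) =
  trans (sym (x∈p∧x∉p-y⇒x≡y y∈S (¬c ∘ inj₂))) (x∈p∧x∉p-y⇒x≡y y∈S (¬c′ ∘ inj₂))
owner-unique {r = (_ , false)} (_ , y≡p) (_ , y≡p′) = trans (sym y≡p) y≡p′

charge : ∀ {n} → Subset n → History n → Fin n → ℕ
charge S h p = count (owns? S p) h

demand : ∀ {n} → Subset n → Fin n → ℕ
demand S p = if does (p ∈? S) then 2 else 1

∑-demand : ∀ {n} (S : Subset n) → ∑[ p < n ] demand S p ≡ n + ∣ S ∣
∑-demand [] = refl
∑-demand {suc n} (inside ∷ S) = trans (cong (2 +_) (∑-demand S)) (cong suc (sym (+-suc n ∣ S ∣)))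
∑-demand (outside ∷ S) = cong suc (∑-demand S)

Ambiguous : ∀ {n} → ℕ → History n → Set
Ambiguous {n} ℓ h = Σ (Subset n) λ S → Σ (Subset n) λ T →
  S ≢ T × Consistent ℓ h S × Consistent ℓ h T

module _ {n ℓ} {h : History n} (justified : All (Justified ℓ h) h) where

  two-covers : ∀ {S T p} → SmallCover ℓ h S → SmallCover ℓ h T → p ∈ S → p ∉ T → Ambiguous ℓ h
  two-covers smallS smallT p∈S p∉T = _ , _ , separated p∈S p∉T ,
    smallCover-consistent justified smallS , smallCover-consistent justified smallT

  module _ {S} (small : SmallCover ℓ h S) where

    slack : suc ∣ S ∣ < ℓ → ∀ {u} → u ∉ S → Ambiguous ℓ h
    slack roomy {u} u∉S = two-covers
      (≤-<-trans (∣p∪⁅x⁆∣≤1+∣p∣ S u) roomy , cover-mono (p⊆p∪q ⁅ u ⁆) (proj₂ small))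
      small (q⊆p∪q S ⁅ u ⁆ (x∈⁅x⁆ u)) u∉S

    -- Unless some answer names p as a knight, S ∪ ⁅ p ⁆ is consistent too.
    outsider : ∀ {p} → p ∉ S → Ambiguous ℓ h ⊎ 1 ≤ charge S h p
    outsider {p} p∉S with any? (owns? S p) h
    ... | yes owned = let (r , r∈h , owns) = find owned in inj₂ (count-∈ (owns? S p) r∈h owns)
    ... | no unowned = inj₁ (_ , _ , separated (q⊆p∪q S ⁅ p ⁆ (x∈⁅x⁆ p)) p∉S , enlarged ,
                             smallCover-consistent justified small)
      where
      clear : ∀ {r} → KnightClear S r → ¬ Owns S p r → KnightClear (S ∪ ⁅ p ⁆) r
      clear {(_ , true)} _ _ = tt
      clear {((i , j) , false)} clearS ¬owns i≢j j∈ with x∈p∪q⁻ S ⁅ p ⁆ j∈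
      ... | inj₁ j∈S = clearS i≢j j∈S
      ... | inj₂ j∈p = ¬owns (i≢j , x∈⁅y⁆⇒x≡y p j∈p)

      enlarged : Consistent ℓ h (S ∪ ⁅ p ⁆)
      enlarged = consistent (≤-trans (∣p∪⁅x⁆∣≤1+∣p∣ S p) (proj₁ small))
        (cover-mono (p⊆p∪q ⁅ p ⁆) (proj₂ small))
        (All.zipWith (uncurry clear) (smallCover-clear justified small , ¬Any⇒All¬ h unowned))

    -- Unless S - p or a swap of p for a neighbour is a small cover, p owns
    -- two different accusations.
    insider : ∀ {p} → p ∈ S → Ambiguous ℓ h ⊎ 2 ≤ charge S h p
    insider {p} p∈S with cover? (S - p) h
    ... | yes cov⁻ =
      inj₁ (two-covers small (≤-<-trans (<⇒≤ (x∈p⇒∣p-x∣<∣p∣ p∈S)) (proj₁ small) , cov⁻) p∈S (x∉p-x S p))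
    ... | no ¬cov⁻ with uncovered (proj₂ small) ¬cov⁻
    ...   | (x , y) , q₀∈h , covS₀ , ¬cov⁻₀ = swap (neighbour (All.lookup justified q₀∈h))
      where
      neighbour : x ≢ y → ∃ λ w → w ≢ p × Covers ⁅ w ⁆ (x , y)
      neighbour x≢y with x ≟ p
      ... | yes refl = y , (λ y≡x → x≢y (sym y≡x)) , inj₂ (x∈⁅x⁆ y)
      ... | no x≢p = x , x≢p , inj₁ (x∈⁅x⁆ x)

      -- T = (S - p) ∪ ⁅ w ⁆ is small, misses p and covers (x , y); if it does not
      -- cover h, an accusation it misses is a second one owned by p.
      swap : (∃ λ w → w ≢ p × Covers ⁅ w ⁆ (x , y)) → Ambiguous ℓ h ⊎ 2 ≤ charge S h p
      swap (w , w≢p , covw₀) with cover? ((S - p) ∪ ⁅ w ⁆) h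
      ... | yes covT = inj₁ (two-covers small (sizeT , covT) p∈S p∉T)
        where
        sizeT : ∣ (S - p) ∪ ⁅ w ⁆ ∣ < ℓ
        sizeT = ≤-<-trans (≤-trans (∣p∪⁅x⁆∣≤1+∣p∣ (S - p) w) (x∈p⇒∣p-x∣<∣p∣ p∈S)) (proj₁ small)
        p∉T : p ∉ (S - p) ∪ ⁅ w ⁆
        p∉T p∈T with x∈p∪q⁻ (S - p) ⁅ w ⁆ p∈T
        ... | inj₁ p∈S-p = x∉p-x S p p∈S-p
        ... | inj₂ p∈w = w≢p (sym (x∈⁅y⁆⇒x≡y w p∈w))
      ... | no ¬covT with uncovered (proj₂ small) ¬covT
      ...   | q₁ , q₁∈h , covS₁ , ¬covT₁ =
        inj₂ (count-∈₂ (owns? S p) q₀∈h q₁∈h distinct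
               (covS₀ , ¬cov⁻₀) (covS₁ , ¬covT₁ ∘ covers-mono (p⊆p∪q ⁅ w ⁆)))
        where
        distinct : ((x , y) , true) ≢ (q₁ , true)
        distinct refl = ¬covT₁ (covers-mono (q⊆p∪q (S - p) ⁅ w ⁆) covw₀)

    demand-met : ∀ p → Ambiguous ℓ h ⊎ demand S p ≤ charge S h p
    demand-met p with p ∈? S
    ... | yes p∈S = insider p∈S
    ... | no p∉S = outsider p∉S

    history-long : (∀ p → demand S p ≤ charge S h p) → n + ∣ S ∣ ≤ length h
    history-long met = begin
      n + ∣ S ∣                     ≡⟨ sym (∑-demand S) ⟩
      ∑[ p < n ] demand S p         ≤⟨ ∑-mono met ⟩
      ∑[ p < n ] charge S h p       ≤⟨ ∑-count≤length (owns? S) owner-unique h ⟩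
      length h                      ∎
      where open ≤-Reasoning

    ambiguous : ℓ ≤ n → length h < n + ℓ ∸ 1 → Ambiguous ℓ h
    ambiguous ℓ≤n short with suc ∣ S ∣ <? ℓ
    ... | yes roomy = slack roomy (proj₂ (nonmember S (≤-trans (<⇒≤ roomy) ℓ≤n)))
    ... | no tight =
      let (p , unmet) = ¬∀⟶∃¬ n _ (λ p → demand S p ≤? charge S h p)
                          (λ met → <⇒≱ short (≤-trans (tight-bound (≮⇒≥ tight)) (history-long met)))
      in [ id , (λ met → contradiction met unmet) ]′ (demand-met p)
      where
      tight-bound : ℓ ≤ suc ∣ S ∣ → n + ℓ ∸ 1 ≤ n + ∣ S ∣
      tight-bound ℓ≤ =
        ≤-trans (∸-monoˡ-≤ 1 (+-monoʳ-≤ n ℓ≤)) (≤-reflexive (cong (_∸ 1) (+-suc n ∣ S ∣)))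

theorem2 : (n ℓ : ℕ) → 1 ≤ ℓ → 2 * ℓ < n →
    Σ (Strategy n) λ σ →
      ((qs : List (Question n)) → Σ (Subset n) λ S → Consistent ℓ (play σ qs) S)
      × ((qs : List (Question n)) → length qs < n + ℓ ∸ 1 →
           Σ (Subset n) λ S → Σ (Subset n) λ T →
             S ≢ T × Consistent ℓ (play σ qs) S × Consistent ℓ (play σ qs) T)
theorem2 n ℓ ℓ≥1 2ℓ<n = keeper ℓ , consistentSet , twoConsistentSets
  where
  open Sound
  ℓ≤n : ℓ ≤ n
  ℓ≤n = ≤-trans (m≤m+n ℓ (ℓ + 0)) (<⇒≤ 2ℓ<n)

  consistentSet : (qs : List (Question n)) → Σ (Subset n) λ S → Consistent ℓ (play (keeper ℓ) qs) S
  consistentSet qs = let s = sound-play ℓ≥1 qs in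
    cover s , smallCover-consistent (justified s) (small s)

  twoConsistentSets : (qs : List (Question n)) → length qs < n + ℓ ∸ 1 →
    Ambiguous ℓ (play (keeper ℓ) qs)
  twoConsistentSets qs short = let s = sound-play ℓ≥1 qs in
    ambiguous (justified s) (small s) ℓ≤n
      (subst (_< n + ℓ ∸ 1) (sym (length-play (keeper ℓ) qs)) short)
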